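{- Let $p$ be a prime and let $n \geq 0$ be an integer with standard base-$p$ representation $n_\ell \cdots n_1 n_0$ (so $n = \sum_{t=0}^{\ell} n_t p^t$ with $n_t \in \{0,1,\dots,p-1\}$). Define \[ T_p(n, x) = \sum_{m = 0}^n x^{\nu_p\left(\binom{n}{m}\right)}, \] and for each $d \in \{0, 1, \dots, p - 1\}$ let \[ M_p(d) = \begin{bmatrix} d + 1 & p - d - 1 \\ d \, x & (p - d) \, x \end{bmatrix}. \] Then \[ T_p(n, x) = \begin{bmatrix} 1 & 0 \end{bmatrix} M_p(n_0) \, M_p(n_1) \, \cdots \, M_p(n_\ell) \begin{bmatrix} 1 \\ 0 \end{bmatrix}. \]
   Context: $\nu_p(N)$ denotes the $p$-adic valuation of a positive integer $N$, i.e. the exponent of the highest power of $p$ dividing $N$. Thus the coefficient of $x^\alpha$ in $T_p(n,x)$ is the number of $m$ with $0 \le m \le n$ and $\nu_p(\binom{n}{m}) = \alpha$. -}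

module Defs where

open import Data.Nat using (ℕ; zero; suc; _+_; _*_; _∸_; _^_; _/_)
open import Data.Nat.Divisibility using (_∣?_)
open import Data.Nat.Combinatorics using (_C_)
open import Relation.Nullary using (yes; no)
open import Relation.Binary.PropositionalEquality using (_≡_)

-- Computed by repeated division; the fuel N is
-- always sufficient since N / p < N.  (Values for p ≤ 1 or N = 0 are
-- irrelevant conventions: 0.)
ν : ℕ → ℕ → ℕ
ν zero _ = 0
ν (suc zero) _ = 0
ν (suc (suc q)) N = go N N
  where
  p = suc (suc q)
  go : ℕ → ℕ → ℕ
  go zero _ = 0
  go (suc f) zero = 0
  go (suc f) (suc k) with p ∣? suc k
  ... | yes _ = suc (go f (suc k / p))
  ... | no _ = 0

sumTo : (ℕ → ℕ) → ℕ → ℕ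
sumTo f zero = f 0
sumTo f (suc n) = sumTo f n + f (suc n)

-- Polynomials in x with natural-number coefficients, as coefficient
-- functions: P k is the coefficient of x^k.  Equality is pointwise.
Poly : Set
Poly = ℕ → ℕ

_≐_ : Poly → Poly → Set
P ≐ Q = ∀ k → P k ≡ Q k

const : ℕ → Poly
const c zero = c
const c (suc _) = 0

linX : ℕ → Poly
linX c zero = 0
linX c (suc zero) = c
linX c (suc (suc _)) = 0

monX : ℕ → Poly
monX zero zero = 1
monX zero (suc _) = 0
monX (suc e) zero = 0
monX (suc e) (suc k) = monX e k

_⊕_ : Poly → Poly → Poly
(P ⊕ Q) k = P k + Q k

_⊗_ : Poly → Poly → Poly
(P ⊗ Q) k = sumTo (λ i → P i * Q (k ∸ i)) k

polySumTo : (ℕ → Poly) → ℕ → Poly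
polySumTo F zero = F 0
polySumTo F (suc n) = polySumTo F n ⊕ F (suc n)

T : ℕ → ℕ → Poly
T p n = polySumTo (λ m → monX (ν p (n C m))) n

record Mat2 : Set where
  constructor mat
  field
    a b c d : Poly
open Mat2 public

_·M_ : Mat2 → Mat2 → Mat2
mat a₁ b₁ c₁ d₁ ·M mat a₂ b₂ c₂ d₂ =
  mat ((a₁ ⊗ a₂) ⊕ (b₁ ⊗ c₂)) ((a₁ ⊗ b₂) ⊕ (b₁ ⊗ d₂))
      ((c₁ ⊗ a₂) ⊕ (d₁ ⊗ c₂)) ((c₁ ⊗ b₂) ⊕ (d₁ ⊗ d₂))

M : ℕ → ℕ → Mat2
M p d = mat (const (d + 1)) (const (p ∸ d ∸ 1)) (linX d) (linX (p ∸ d))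

Mprod : ℕ → (ℕ → ℕ) → ℕ → Mat2
Mprod p ds zero = M p (ds 0)
Mprod p ds (suc ℓ) = Mprod p ds ℓ ·M M p (ds (suc ℓ))

sandwich : Mat2 → Poly
sandwich A = (u₁ ⊗ const 1) ⊕ (u₂ ⊗ const 0)
  where
  u₁ = (const 1 ⊗ a A) ⊕ (const 0 ⊗ c A)
  u₂ = (const 1 ⊗ b A) ⊕ (const 0 ⊗ d A)

-- Let A n = Σ_{m ≤ n} x^{ν_p (n C m)} = T_p(n, x) and B n = Σ_{m < n} x^{1 + ν_p(n! / (m! (n-1-m)!))}.
-- For n = d + p n' with d < p, sort the m ≤ n by their last base-p digit e: by Kummer's
-- theorem, e ≤ d costs no borrow and gives the exponent of (n' C m'), while e > d borrows
-- once and gives 1 plus the B-type exponent for (n', m').  Counting digits then yields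
-- (A n, B n)ᵀ = M_p(d) (A n', B n')ᵀ, and iterating down to (A 0, B 0) = (1, 0) gives the
-- matrix product.  Kummer's borrow rule itself follows from Legendre's ν_p((d + p r)!) = r + ν_p(r!).
module Submission where

open import Data.Nat
open import Data.Nat.Combinatorics using (_C_; nCk≡n!/k![n-k]!; k![n∸k]!∣n!)
open import Data.Nat.DivMod using (m*n/n≡m; m/n*n≡m)
open import Data.Nat.Divisibility
open import Data.Nat.Induction using (<-wellFounded)
open import Data.Nat.Primality using (Prime; euclidsLemma)
open import Data.Nat.Properties
open import Algebra.Properties.CommutativeSemigroup +-commutativeSemigroup using ()
  renaming (interchange to +-interchange)
open import Algebra.Properties.CommutativeSemigroup *-commutativeSemigroup using ()
  renaming (interchange to *-interchange; x∙yz≈y∙xz to x*yz≡y*xz)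
open import Data.Nat.Tactic.RingSolver using (solve-∀)
open import Data.Product using (∃-syntax; _×_; _,_)
open import Data.Sum using (_⊎_; inj₁; inj₂)
open import Induction.WellFounded using (Acc; acc)
open import Relation.Binary.PropositionalEquality
open import Relation.Nullary using (¬_; yes; no; contradiction)

open import Defs

sumBelow : (ℕ → ℕ) → ℕ → ℕ
sumBelow f zero    = 0
sumBelow f (suc n) = sumBelow f n + f n

sumBelow-cong : ∀ {f g} n → (∀ i → i < n → f i ≡ g i) → sumBelow f n ≡ sumBelow g n
sumBelow-cong zero    f≡g = refl
sumBelow-cong (suc n) f≡g =
  cong₂ _+_ (sumBelow-cong n (λ i i<n → f≡g i (m<n⇒m<1+n i<n))) (f≡g n (n<1+n n))

sumBelow-const : ∀ c n → sumBelow (λ _ → c) n ≡ n * c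
sumBelow-const c zero    = refl
sumBelow-const c (suc n) = trans (cong (_+ c) (sumBelow-const c n)) (+-comm (n * c) c)

sumBelow-+ : ∀ f g n → sumBelow (λ i → f i + g i) n ≡ sumBelow f n + sumBelow g n
sumBelow-+ f g zero    = refl
sumBelow-+ f g (suc n) =
  trans (cong (_+ (f n + g n)) (sumBelow-+ f g n)) (+-interchange (sumBelow f n) (sumBelow g n) (f n) (g n))

sumBelow-* : ∀ c f n → sumBelow (λ i → c * f i) n ≡ c * sumBelow f n
sumBelow-* c f zero    = sym (*-zeroʳ c)
sumBelow-* c f (suc n) =
  trans (cong (_+ c * f n) (sumBelow-* c f n)) (sym (*-distribˡ-+ c (sumBelow f n) (f n)))

sumBelow-split : ∀ f a b → sumBelow f (a + b) ≡ sumBelow f a + sumBelow (λ i → f (a + i)) b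
sumBelow-split f a zero    = trans (cong (sumBelow f) (+-identityʳ a)) (sym (+-identityʳ _))
sumBelow-split f a (suc b) = begin
  sumBelow f (a + suc b)                                  ≡⟨ cong (sumBelow f) (+-suc a b) ⟩
  sumBelow f (a + b) + f (a + b)                          ≡⟨ cong (_+ f (a + b)) (sumBelow-split f a b) ⟩
  sumBelow f a + sumBelow (λ i → f (a + i)) b + f (a + b) ≡⟨ +-assoc (sumBelow f a) _ _ ⟩
  sumBelow f a + sumBelow (λ i → f (a + i)) (suc b)       ∎
  where open ≡-Reasoning

sumBelow-blocks : ∀ P f n → sumBelow f (P * n) ≡ sumBelow (λ j → sumBelow (λ e → f (e + P * j)) P) n
sumBelow-blocks P f zero    = cong (sumBelow f) (*-zeroʳ P)
sumBelow-blocks P f (suc n) = begin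
  sumBelow f (P * suc n)                                     ≡⟨ cong (sumBelow f) (trans (*-suc P n) (+-comm P (P * n))) ⟩
  sumBelow f (P * n + P)                                     ≡⟨ sumBelow-split f (P * n) P ⟩
  sumBelow f (P * n) + sumBelow (λ e → f (P * n + e)) P      ≡⟨ cong₂ _+_ (sumBelow-blocks P f n)
                                                                    (sumBelow-cong P (λ e _ → cong f (+-comm (P * n) e))) ⟩
  sumBelow (λ j → sumBelow (λ e → f (e + P * j)) P) (suc n)  ∎
  where open ≡-Reasoning

sumBelow-digits : ∀ P s n' (g u v : ℕ → ℕ) → s ≤ P →
  (∀ e j → e < s → j ≤ n' → g (e + P * j) ≡ u j) →
  (∀ e j → s ≤ e → e < P → j < n' → g (e + P * j) ≡ v j) →
  sumBelow g (s + P * n') ≡ s * sumBelow u (suc n') + (P ∸ s) * sumBelow v n'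
sumBelow-digits P s n' g u v s≤P low high = begin
  sumBelow g (s + P * n')
    ≡⟨ cong (sumBelow g) (+-comm s (P * n')) ⟩
  sumBelow g (P * n' + s)
    ≡⟨ sumBelow-split g (P * n') s ⟩
  sumBelow g (P * n') + sumBelow (λ e → g (P * n' + e)) s
    ≡⟨ cong₂ _+_ (sumBelow-blocks P g n') top ⟩
  sumBelow (λ j → sumBelow (λ e → g (e + P * j)) P) n' + s * u n'
    ≡⟨ cong (_+ s * u n') (sumBelow-cong n' block) ⟩
  sumBelow (λ j → s * u j + (P ∸ s) * v j) n' + s * u n'
    ≡⟨ cong (_+ s * u n') (trans (sumBelow-+ _ _ n') (cong₂ _+_ (sumBelow-* s u n') (sumBelow-* (P ∸ s) v n'))) ⟩
  s * sumBelow u n' + (P ∸ s) * sumBelow v n' + s * u n'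
    ≡⟨ regroup s (sumBelow u n') (P ∸ s) (sumBelow v n') (u n') ⟩
  s * sumBelow u (suc n') + (P ∸ s) * sumBelow v n'
    ∎
  where
  open ≡-Reasoning
  regroup : ∀ a x b y z → a * x + b * y + a * z ≡ a * (x + z) + b * y
  regroup = solve-∀
  top : sumBelow (λ e → g (P * n' + e)) s ≡ s * u n'
  top = trans (sumBelow-cong s (λ e e<s → trans (cong g (+-comm (P * n') e)) (low e n' e<s ≤-refl)))
              (sumBelow-const (u n') s)
  block : ∀ j → j < n' → sumBelow (λ e → g (e + P * j)) P ≡ s * u j + (P ∸ s) * v j
  block j j<n' = begin
    sumBelow (λ e → g (e + P * j)) P
      ≡⟨ cong (sumBelow (λ e → g (e + P * j))) (sym (m+[n∸m]≡n s≤P)) ⟩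
    sumBelow (λ e → g (e + P * j)) (s + (P ∸ s))
      ≡⟨ sumBelow-split (λ e → g (e + P * j)) s (P ∸ s) ⟩
    sumBelow (λ e → g (e + P * j)) s + sumBelow (λ i → g (s + i + P * j)) (P ∸ s)
      ≡⟨ cong₂ _+_ (sumBelow-cong s (λ e e<s → low e j e<s (<⇒≤ j<n')))
                   (sumBelow-cong (P ∸ s) (λ i i<P∸s → high (s + i) j (m≤m+n s i) (subst (s + i <_) (m+[n∸m]≡n s≤P) (+-monoʳ-< s i<P∸s)) j<n')) ⟩
    sumBelow (λ _ → u j) s + sumBelow (λ _ → v j) (P ∸ s)
      ≡⟨ cong₂ _+_ (sumBelow-const (u j) s) (sumBelow-const (v j) (P ∸ s)) ⟩
    s * u j + (P ∸ s) * v j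
      ∎

sumTo-cong : ∀ {f g} n → (∀ i → i ≤ n → f i ≡ g i) → sumTo f n ≡ sumTo g n
sumTo-cong zero    f≡g = f≡g 0 z≤n
sumTo-cong (suc n) f≡g = cong₂ _+_ (sumTo-cong n (λ i i≤n → f≡g i (m≤n⇒m≤1+n i≤n))) (f≡g (suc n) ≤-refl)

sumTo-+ : ∀ f g n → sumTo (λ i → f i + g i) n ≡ sumTo f n + sumTo g n
sumTo-+ f g zero    = refl
sumTo-+ f g (suc n) =
  trans (cong (_+ (f (suc n) + g (suc n))) (sumTo-+ f g n)) (+-interchange (sumTo f n) (sumTo g n) (f (suc n)) (g (suc n)))

sumTo-* : ∀ c f n → sumTo (λ i → c * f i) n ≡ c * sumTo f n
sumTo-* c f zero    = refl
sumTo-* c f (suc n) = trans (cong (_+ c * f (suc n)) (sumTo-* c f n)) (sym (*-distribˡ-+ c _ _))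

sumTo-suc : ∀ f n → sumTo f (suc n) ≡ f 0 + sumTo (λ i → f (suc i)) n
sumTo-suc f zero    = refl
sumTo-suc f (suc n) = trans (cong (_+ f (suc (suc n))) (sumTo-suc f n)) (+-assoc (f 0) _ _)

sumTo-head : ∀ f n → (∀ i → f (suc i) ≡ 0) → sumTo f n ≡ f 0
sumTo-head f zero    _   = refl
sumTo-head f (suc n) f≡0 = trans (cong₂ _+_ (sumTo-head f n f≡0) (f≡0 n)) (+-identityʳ (f 0))

sumTo-last : ∀ f n → (∀ i → i < n → f i ≡ 0) → sumTo f n ≡ f n
sumTo-last f zero    _   = refl
sumTo-last f (suc n) f≡0 = cong (_+ f (suc n)) (trans (sumTo-last f n (λ i i<n → f≡0 i (m<n⇒m<1+n i<n))) (f≡0 n ≤-refl))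

scale : ℕ → Poly → Poly
scale c P k = c * P k

shift : Poly → Poly
shift P zero    = 0
shift P (suc k) = P k

⊗-congˡ : ∀ {P P'} Q → P ≐ P' → (P ⊗ Q) ≐ (P' ⊗ Q)
⊗-congˡ Q P≐P' k = sumTo-cong k (λ i _ → cong (_* Q (k ∸ i)) (P≐P' i))

⊗-congʳ : ∀ P {Q Q'} → Q ≐ Q' → (P ⊗ Q) ≐ (P ⊗ Q')
⊗-congʳ P Q≐Q' k = sumTo-cong k (λ i _ → cong (P i *_) (Q≐Q' (k ∸ i)))

⊗-distribʳ-⊕ : ∀ P Q S → ((P ⊕ Q) ⊗ S) ≐ ((P ⊗ S) ⊕ (Q ⊗ S))
⊗-distribʳ-⊕ P Q S k = trans (sumTo-cong k (λ i _ → *-distribʳ-+ (S (k ∸ i)) (P i) (Q i))) (sumTo-+ _ _ k)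

⊗-distribˡ-⊕ : ∀ P Q S → (P ⊗ (Q ⊕ S)) ≐ ((P ⊗ Q) ⊕ (P ⊗ S))
⊗-distribˡ-⊕ P Q S k = trans (sumTo-cong k (λ i _ → *-distribˡ-+ (P i) (Q (k ∸ i)) (S (k ∸ i)))) (sumTo-+ _ _ k)

scale-⊗ : ∀ c P Q → (scale c P ⊗ Q) ≐ scale c (P ⊗ Q)
scale-⊗ c P Q k = trans (sumTo-cong k (λ i _ → *-assoc c (P i) (Q (k ∸ i)))) (sumTo-* c _ k)

⊗-scale : ∀ c P Q → (P ⊗ scale c Q) ≐ scale c (P ⊗ Q)
⊗-scale c P Q k = trans (sumTo-cong k (λ i _ → x*yz≡y*xz (P i) c (Q (k ∸ i)))) (sumTo-* c _ k)

shift-⊗ : ∀ P Q → (shift P ⊗ Q) ≐ shift (P ⊗ Q)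
shift-⊗ P Q zero    = refl
shift-⊗ P Q (suc k) = sumTo-suc _ k

⊗-shift : ∀ P Q → (P ⊗ shift Q) ≐ shift (P ⊗ Q)
⊗-shift P Q zero    = *-zeroʳ (P 0)
⊗-shift P Q (suc k) = begin
  sumTo (λ i → P i * shift Q (suc k ∸ i)) k + P (suc k) * shift Q (suc k ∸ suc k)
    ≡⟨ cong₂ _+_ (sumTo-cong k (λ i i≤k → cong (λ j → P i * shift Q j) (+-∸-assoc 1 i≤k)))
                 (cong (λ j → P (suc k) * shift Q j) (n∸n≡0 k)) ⟩
  sumTo (λ i → P i * Q (k ∸ i)) k + P (suc k) * 0
    ≡⟨ trans (cong (sumTo (λ i → P i * Q (k ∸ i)) k +_) (*-zeroʳ (P (suc k)))) (+-identityʳ _) ⟩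
  (P ⊗ Q) k
    ∎
  where open ≡-Reasoning

const-⊗ : ∀ c P → (const c ⊗ P) ≐ scale c P
const-⊗ c P zero    = refl
const-⊗ c P (suc k) = trans (sumTo-suc _ k) (trans (cong (c * P (suc k) +_) (sumTo-head _ k (λ _ → refl))) (+-identityʳ _))

⊗-const : ∀ P c → (P ⊗ const c) ≐ scale c P
⊗-const P c k = begin
  (P ⊗ const c) k       ≡⟨ sumTo-last _ k (λ i i<k → trans (cong (P i *_) (const-pos i<k)) (*-zeroʳ (P i))) ⟩
  P k * const c (k ∸ k) ≡⟨ cong (λ j → P k * const c j) (n∸n≡0 k) ⟩
  P k * c               ≡⟨ *-comm (P k) c ⟩
  c * P k               ∎
  where
  open ≡-Reasoning
  const-pos : ∀ {i k} → i < k → const c (k ∸ i) ≡ 0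
  const-pos {zero}  {suc k} _         = refl
  const-pos {suc i} {suc k} (s≤s i<k) = const-pos i<k

shift-cong : ∀ {P Q} → P ≐ Q → shift P ≐ shift Q
shift-cong P≐Q zero    = refl
shift-cong P≐Q (suc k) = P≐Q k

linX≐shift-const : ∀ c → linX c ≐ shift (const c)
linX≐shift-const c zero          = refl
linX≐shift-const c (suc zero)    = refl
linX≐shift-const c (suc (suc k)) = refl

linX-⊗ : ∀ c P → (linX c ⊗ P) ≐ shift (scale c P)
linX-⊗ c P k = begin
  (linX c ⊗ P) k            ≡⟨ ⊗-congˡ P (linX≐shift-const c) k ⟩
  (shift (const c) ⊗ P) k   ≡⟨ shift-⊗ (const c) P k ⟩
  shift (const c ⊗ P) k     ≡⟨ shift-cong (const-⊗ c P) k ⟩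
  shift (scale c P) k       ∎
  where open ≡-Reasoning

⊗-linX : ∀ P c → (P ⊗ linX c) ≐ shift (scale c P)
⊗-linX P c k = begin
  (P ⊗ linX c) k            ≡⟨ ⊗-congʳ P (linX≐shift-const c) k ⟩
  (P ⊗ shift (const c)) k   ≡⟨ ⊗-shift P (const c) k ⟩
  shift (P ⊗ const c) k     ≡⟨ shift-cong (⊗-const P c) k ⟩
  shift (scale c P) k       ∎
  where open ≡-Reasoning

⊗-assoc-const : ∀ P c Q → ((P ⊗ const c) ⊗ Q) ≐ (P ⊗ (const c ⊗ Q))
⊗-assoc-const P c Q k = begin
  ((P ⊗ const c) ⊗ Q) k     ≡⟨ ⊗-congˡ Q (⊗-const P c) k ⟩
  (scale c P ⊗ Q) k         ≡⟨ scale-⊗ c P Q k ⟩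
  c * (P ⊗ Q) k             ≡⟨ ⊗-scale c P Q k ⟨
  (P ⊗ scale c Q) k         ≡⟨ ⊗-congʳ P (const-⊗ c Q) k ⟨
  (P ⊗ (const c ⊗ Q)) k     ∎
  where open ≡-Reasoning

⊗-assoc-linX : ∀ P c Q → ((P ⊗ linX c) ⊗ Q) ≐ (P ⊗ (linX c ⊗ Q))
⊗-assoc-linX P c Q k = begin
  ((P ⊗ linX c) ⊗ Q) k          ≡⟨ ⊗-congˡ Q (⊗-linX P c) k ⟩
  (shift (scale c P) ⊗ Q) k     ≡⟨ shift-⊗ (scale c P) Q k ⟩
  shift (scale c P ⊗ Q) k       ≡⟨ shift-cong (scale-⊗ c P Q) k ⟩
  shift (scale c (P ⊗ Q)) k     ≡⟨ shift-cong (⊗-scale c P Q) k ⟨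
  shift (P ⊗ scale c Q) k       ≡⟨ ⊗-shift P (scale c Q) k ⟨
  (P ⊗ shift (scale c Q)) k     ≡⟨ ⊗-congʳ P (linX-⊗ c Q) k ⟨
  (P ⊗ (linX c ⊗ Q)) k          ∎
  where open ≡-Reasoning

rowCol : Mat2 → Poly → Poly → Poly
rowCol R u v = (a R ⊗ u) ⊕ (b R ⊗ v)

rowCol-·M : ∀ R α β γ δ u v →
  rowCol (R ·M mat (const α) (const β) (linX γ) (linX δ)) u v
    ≐ rowCol R ((const α ⊗ u) ⊕ (const β ⊗ v)) ((linX γ ⊗ u) ⊕ (linX δ ⊗ v))
rowCol-·M (mat r₁ r₂ _ _) α β γ δ u v k = begin
  (((r₁ ⊗ const α) ⊕ (r₂ ⊗ linX γ)) ⊗ u) k + (((r₁ ⊗ const β) ⊕ (r₂ ⊗ linX δ)) ⊗ v) k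
    ≡⟨ cong₂ _+_ (⊗-distribʳ-⊕ (r₁ ⊗ const α) (r₂ ⊗ linX γ) u k) (⊗-distribʳ-⊕ (r₁ ⊗ const β) (r₂ ⊗ linX δ) v k) ⟩
  ((r₁ ⊗ const α) ⊗ u) k + ((r₂ ⊗ linX γ) ⊗ u) k + (((r₁ ⊗ const β) ⊗ v) k + ((r₂ ⊗ linX δ) ⊗ v) k)
    ≡⟨ cong₂ _+_ (cong₂ _+_ (⊗-assoc-const r₁ α u k) (⊗-assoc-linX r₂ γ u k))
                 (cong₂ _+_ (⊗-assoc-const r₁ β v k) (⊗-assoc-linX r₂ δ v k)) ⟩
  (r₁ ⊗ (const α ⊗ u)) k + (r₂ ⊗ (linX γ ⊗ u)) k + ((r₁ ⊗ (const β ⊗ v)) k + (r₂ ⊗ (linX δ ⊗ v)) k)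
    ≡⟨ +-interchange ((r₁ ⊗ (const α ⊗ u)) k) ((r₂ ⊗ (linX γ ⊗ u)) k) ((r₁ ⊗ (const β ⊗ v)) k) ((r₂ ⊗ (linX δ ⊗ v)) k) ⟩
  (r₁ ⊗ (const α ⊗ u)) k + (r₁ ⊗ (const β ⊗ v)) k + ((r₂ ⊗ (linX γ ⊗ u)) k + (r₂ ⊗ (linX δ ⊗ v)) k)
    ≡⟨ cong₂ _+_ (⊗-distribˡ-⊕ r₁ (const α ⊗ u) (const β ⊗ v) k) (⊗-distribˡ-⊕ r₂ (linX γ ⊗ u) (linX δ ⊗ v) k) ⟨
  (r₁ ⊗ ((const α ⊗ u) ⊕ (const β ⊗ v))) k + (r₂ ⊗ ((linX γ ⊗ u) ⊕ (linX δ ⊗ v))) k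
    ∎
  where
  open ≡-Reasoning

rowCol-cong : ∀ R {u u' v v'} → u ≐ u' → v ≐ v' → rowCol R u v ≐ rowCol R u' v'
rowCol-cong R u≐u' v≐v' k = cong₂ _+_ (⊗-congʳ (a R) u≐u' k) (⊗-congʳ (b R) v≐v' k)

rowCol-e₁ : ∀ R → rowCol R (const 1) (const 0) ≐ a R
rowCol-e₁ R k = begin
  (a R ⊗ const 1) k + (b R ⊗ const 0) k ≡⟨ cong₂ _+_ (⊗-const (a R) 1 k) (⊗-const (b R) 0 k) ⟩
  1 * a R k + 0                         ≡⟨ trans (+-identityʳ _) (*-identityˡ (a R k)) ⟩
  a R k                                 ∎
  where open ≡-Reasoning

sandwich≐a : ∀ R → sandwich R ≐ a R
sandwich≐a R k = begin
  sandwich R k                                    ≡⟨ cong₂ _+_ (⊗-const u₁ 1 k) (⊗-const u₂ 0 k) ⟩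
  1 * u₁ k + 0                                    ≡⟨ trans (+-identityʳ _) (*-identityˡ (u₁ k)) ⟩
  (const 1 ⊗ a R) k + (const 0 ⊗ c R) k           ≡⟨ cong₂ _+_ (const-⊗ 1 (a R) k) (const-⊗ 0 (c R) k) ⟩
  1 * a R k + 0                                   ≡⟨ trans (+-identityʳ _) (*-identityˡ (a R k)) ⟩
  a R k                                           ∎
  where
  open ≡-Reasoning
  u₁ = (const 1 ⊗ a R) ⊕ (const 0 ⊗ c R)
  u₂ = (const 1 ⊗ b R) ⊕ (const 0 ⊗ d R)

polySumTo-sumBelow : ∀ F n k → polySumTo F n k ≡ sumBelow (λ m → F m k) (suc n)
polySumTo-sumBelow F zero    k = refl
polySumTo-sumBelow F (suc n) k = cong (_+ F (suc n) k) (polySumTo-sumBelow F n k)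

fromDigits : ℕ → (ℕ → ℕ) → ℕ → ℕ → ℕ
fromDigits P ds s zero    = 0
fromDigits P ds s (suc j) = ds s + P * fromDigits P ds (suc s) j

sumTo-fromDigits : ∀ P ds s ℓ → sumTo (λ t → ds (s + t) * P ^ t) ℓ ≡ fromDigits P ds s (suc ℓ)
sumTo-fromDigits P ds s zero = begin
  ds (s + 0) * 1   ≡⟨ trans (*-identityʳ _) (cong ds (+-identityʳ s)) ⟩
  ds s             ≡⟨ sym (trans (cong (ds s +_) (*-zeroʳ P)) (+-identityʳ (ds s))) ⟩
  ds s + P * 0     ∎
  where open ≡-Reasoning
sumTo-fromDigits P ds s (suc ℓ) = begin
  sumTo (λ t → ds (s + t) * P ^ t) (suc ℓ)
    ≡⟨ sumTo-suc _ ℓ ⟩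
  ds (s + 0) * 1 + sumTo (λ t → ds (s + suc t) * (P * P ^ t)) ℓ
    ≡⟨ cong₂ _+_ (trans (*-identityʳ _) (cong ds (+-identityʳ s)))
                 (sumTo-cong ℓ (λ t _ → trans (cong (_* (P * P ^ t)) (cong ds (+-suc s t))) (x*yz≡y*xz (ds (suc s + t)) P (P ^ t)))) ⟩
  ds s + sumTo (λ t → P * (ds (suc s + t) * P ^ t)) ℓ
    ≡⟨ cong (ds s +_) (trans (sumTo-* P _ ℓ) (cong (P *_) (sumTo-fromDigits P ds (suc s) ℓ))) ⟩
  ds s + P * fromDigits P ds (suc s) (suc ℓ)
    ∎
  where
  open ≡-Reasoning

nCk*k!*[n∸k]!≡n! : ∀ {n k} → k ≤ n → (n C k) * (k ! * (n ∸ k) !) ≡ n !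
nCk*k!*[n∸k]!≡n! {n} {k} k≤n = begin
  (n C k) * (k ! * (n ∸ k) !)               ≡⟨ cong (_* (k ! * (n ∸ k) !)) (nCk≡n!/k![n-k]! k≤n) ⟩
  n ! / (k ! * (n ∸ k) !) * (k ! * (n ∸ k) !) ≡⟨ m/n*n≡m (k![n∸k]!∣n! k≤n) ⟩
  n !                                       ∎
  where
  open ≡-Reasoning
  instance _ = k !* (n ∸ k) !≢0

digit-sum : ∀ P e f m' r' → (e + P * m') + (f + P * r') ≡ (e + f) + P * (m' + r')
digit-sum = solve-∀

carry-sum : ∀ P {s d} m' r' → s ≡ d + P → s + P * (m' + r') ≡ d + P * suc (m' + r')
carry-sum P {d = d} m' r' refl = trans (+-assoc d P (P * (m' + r'))) (cong (d +_) (sym (*-suc P (m' + r'))))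

module Valuation (q : ℕ) where

  p : ℕ
  p = 2 + q

  -- `ν p N` unfolds to a fuel-driven loop local to `Defs` (its first argument is the unused
  -- clause variable N).  Abstracting everything to variables in ν-step makes the equation a
  -- pattern-unification problem, which names that loop `loop`.
  mutual
    loop : ℕ → ℕ → ℕ → ℕ
    loop = _

    ν-step : ∀ k → p ∣ suc k → ν p (suc k) ≡ suc (loop (suc k) k (suc k / p))
    ν-step k p∣ with p ∣? suc k
    ... | no p∤ = contradiction p∣ p∤
    ... | yes _ with suc k / p
    ...   | M with suc k
    ...     | N = refl

  loop-p^j*u : ∀ N f j M u → j < f → M ≡ p ^ j * u → ¬ p ∣ u → loop N f M ≡ j
  loop-p^j*u N (suc f) j zero u j<f eq p∤u with m*n≡0⇒m≡0∨n≡0 (p ^ j) (sym eq)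
  ... | inj₁ p^j≡0 = contradiction p^j≡0 (≢-nonZero⁻¹ _ {{m^n≢0 p j}})
  ... | inj₂ refl  = contradiction (p ∣0) p∤u
  loop-p^j*u N (suc f) zero (suc k) u j<f eq p∤u with p ∣? suc k
  ... | no _   = refl
  ... | yes p∣ = contradiction (subst (p ∣_) (trans eq (*-identityˡ u)) p∣) p∤u
  loop-p^j*u N (suc f) (suc j) (suc k) u (s≤s j<f) eq p∤u with p ∣? suc k
  ... | no p∤ = contradiction (subst (p ∣_) (sym (trans eq (*-assoc p (p ^ j) u))) (m∣m*n (p ^ j * u))) p∤
  ... | yes _ = cong suc (loop-p^j*u N f j (suc k / p) u j<f divided p∤u)
    where
    divided : suc k / p ≡ p ^ j * u
    divided = begin
      suc k / p             ≡⟨ cong (_/ p) (trans eq (trans (*-assoc p (p ^ j) u) (*-comm p (p ^ j * u)))) ⟩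
      p ^ j * u * p / p     ≡⟨ m*n/n≡m (p ^ j * u) p ⟩
      p ^ j * u             ∎
      where open ≡-Reasoning

  n<p^n : ∀ n → n < p ^ n
  n<p^n zero    = s≤s z≤n
  n<p^n (suc n) = begin-strict
    suc n                     ≡⟨ +-comm 1 n ⟩
    n + 1                     <⟨ +-mono-<-≤ (n<p^n n) (≤-trans (m^n>0 p n) (m≤n*m (p ^ n) (suc q))) ⟩
    p ^ n + suc q * p ^ n     ∎
    where open ≤-Reasoning

  ν-p^j*u : ∀ j u → ¬ p ∣ u → ν p (p ^ j * u) ≡ j
  ν-p^j*u j zero    p∤u = contradiction (p ∣0) p∤u
  ν-p^j*u j (suc u) p∤u =
    loop-p^j*u N N j N (suc u) (≤-trans (n<p^n j) (m≤m*n (p ^ j) (suc u))) refl p∤u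
    where N = p ^ j * suc u

  ν-indivisible : ∀ u → ¬ p ∣ u → ν p u ≡ 0
  ν-indivisible u p∤u = trans (cong (ν p) (sym (*-identityˡ u))) (ν-p^j*u 0 u p∤u)

  p∤1 : ¬ p ∣ 1
  p∤1 p∣1 = <⇒≱ (s≤s (s≤s z≤n)) (∣⇒≤ p∣1)

  ν-p : ν p p ≡ 1
  ν-p = trans (cong (ν p) (sym (trans (*-identityʳ (p * 1)) (*-identityʳ p)))) (ν-p^j*u 1 1 p∤1)

  p-adic-split : ∀ N → .{{NonZero N}} → ∃[ j ] ∃[ u ] N ≡ p ^ j * u × ¬ p ∣ u
  p-adic-split N = go N (<-wellFounded N)
    where
    go : ∀ N → Acc _<_ N → .{{NonZero N}} → ∃[ j ] ∃[ u ] N ≡ p ^ j * u × ¬ p ∣ u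
    go N (acc rec) with p ∣? N
    ... | no p∤N = 0 , N , sym (*-identityˡ N) , p∤N
    ... | yes (divides zero refl) = contradiction refl (≢-nonZero⁻¹ N)
    ... | yes (divides k@(suc _) refl) with go k (rec (m<m*n k p (s≤s (s≤s z≤n))))
    ...   | j , u , k≡ , p∤u = suc j , u , trans (cong (_* p) k≡) (rotate (p ^ j) u p) , p∤u
      where
      rotate : ∀ a b c → a * b * c ≡ c * a * b
      rotate = solve-∀

module PrimeValuation (q : ℕ) (p-prime : Prime (2 + q)) where

  open Valuation q public

  ν-* : ∀ a b → .{{NonZero a}} → .{{NonZero b}} → ν p (a * b) ≡ ν p a + ν p b
  ν-* a b with p-adic-split a | p-adic-split b
  ... | i , u , refl , p∤u | j , w , refl , p∤w = begin
    ν p (p ^ i * u * (p ^ j * w))  ≡⟨ cong (ν p) regroup ⟩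
    ν p (p ^ (i + j) * (u * w))    ≡⟨ ν-p^j*u (i + j) (u * w) p∤u*w ⟩
    i + j                          ≡⟨ sym (cong₂ _+_ (ν-p^j*u i u p∤u) (ν-p^j*u j w p∤w)) ⟩
    ν p (p ^ i * u) + ν p (p ^ j * w) ∎
    where
    open ≡-Reasoning
    regroup : p ^ i * u * (p ^ j * w) ≡ p ^ (i + j) * (u * w)
    regroup = trans (*-interchange (p ^ i) u (p ^ j) w) (cong (_* (u * w)) (sym (^-distribˡ-+-* p i j)))
    p∤u*w : ¬ p ∣ u * w
    p∤u*w p∣u*w with euclidsLemma u w p-prime p∣u*w
    ... | inj₁ p∣u = p∤u p∣u
    ... | inj₂ p∣w = p∤w p∣w

  ν! : ℕ → ℕ
  ν! n = ν p (n !)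

  ν!-suc : ∀ n → ν! (suc n) ≡ ν p (suc n) + ν! n
  ν!-suc n = ν-* (suc n) (n !) {{_}} {{n !≢0}}

  p∤digit+p* : ∀ d r → suc d < p → ¬ p ∣ suc d + p * r
  p∤digit+p* d r 1+d<p p∣ = <⇒≱ 1+d<p (∣⇒≤ (∣m+n∣m⇒∣n (subst (p ∣_) (+-comm (suc d) (p * r)) p∣) (m∣m*n r)))

  ν!-digit+p* : ∀ d r → d < p → ν! (d + p * r) ≡ ν! (p * r)
  ν!-digit+p* zero    r _   = refl
  ν!-digit+p* (suc d) r d<p = begin
    ν! (suc d + p * r)                       ≡⟨ ν!-suc (d + p * r) ⟩
    ν p (suc d + p * r) + ν! (d + p * r)     ≡⟨ cong (_+ ν! (d + p * r)) (ν-indivisible _ (p∤digit+p* d r d<p)) ⟩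
    ν! (d + p * r)                           ≡⟨ ν!-digit+p* d r (<-trans (n<1+n d) d<p) ⟩
    ν! (p * r)                               ∎
    where open ≡-Reasoning

  ν!-p* : ∀ r → ν! (p * r) ≡ r + ν! r
  ν!-p* zero rewrite *-zeroʳ p = ν-indivisible 1 p∤1
  ν!-p* (suc r) = begin
    ν! (p * suc r)                               ≡⟨ cong ν! (*-suc p r) ⟩
    ν! (suc (suc q + p * r))                     ≡⟨ ν!-suc (suc q + p * r) ⟩
    ν p (p + p * r) + ν! (suc q + p * r)         ≡⟨ cong₂ _+_ ν-p*suc (ν!-digit+p* (suc q) r ≤-refl) ⟩
    (1 + ν p (suc r)) + ν! (p * r)               ≡⟨ cong ((1 + ν p (suc r)) +_) (ν!-p* r) ⟩
    (1 + ν p (suc r)) + (r + ν! r)               ≡⟨ shuffle (ν p (suc r)) r (ν! r) ⟩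
    suc r + (ν p (suc r) + ν! r)                 ≡⟨ cong (suc r +_) (sym (ν!-suc r)) ⟩
    suc r + ν! (suc r)                           ∎
    where
    open ≡-Reasoning
    shuffle : ∀ a b c → (1 + a) + (b + c) ≡ suc b + (a + c)
    shuffle = solve-∀
    ν-p*suc : ν p (p + p * r) ≡ 1 + ν p (suc r)
    ν-p*suc = trans (cong (ν p) (sym (*-suc p r))) (trans (ν-* p (suc r)) (cong (_+ ν p (suc r)) ν-p))

  ν!-digit : ∀ d r → d < p → ν! (d + p * r) ≡ r + ν! r
  ν!-digit d r d<p = trans (ν!-digit+p* d r d<p) (ν!-p* r)

module Kummer (q : ℕ) (p-prime : Prime (2 + q)) where

  open PrimeValuation q p-prime public

  Splits : ℕ → ℕ → ℕ → ℕ → Set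
  Splits n m r k = ν! n ≡ k + (ν! m + ν! r)

  binomial-splits : ∀ {n} m r → m + r ≡ n → Splits n m r (ν p (n C m))
  binomial-splits m r refl = begin
    ν! (m + r)                                   ≡⟨ cong (ν p) (sym C*m!*r!≡n!) ⟩
    ν p (((m + r) C m) * (m ! * r !))            ≡⟨ ν-* ((m + r) C m) (m ! * r !) {{C≢0}} {{m !* r !≢0}} ⟩
    ν p ((m + r) C m) + ν p (m ! * r !)          ≡⟨ cong (ν p ((m + r) C m) +_) (ν-* (m !) (r !) {{m !≢0}} {{r !≢0}}) ⟩
    ν p ((m + r) C m) + (ν! m + ν! r)            ∎
    where
    open ≡-Reasoning
    C*m!*r!≡n! : ((m + r) C m) * (m ! * r !) ≡ (m + r) !
    C*m!*r!≡n! = subst (λ x → ((m + r) C m) * (m ! * x !) ≡ (m + r) !) (m+n∸m≡n m r)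
                       (nCk*k!*[n∸k]!≡n! (m≤m+n m r))
    C≢0 : NonZero ((m + r) C m)
    C≢0 = m*n≢0⇒m≢0 _ {{subst NonZero (sym C*m!*r!≡n!) ((m + r) !≢0)}}

  β : ℕ → ℕ → ℕ
  β n m = ν p n + ν p (pred n C m)

  β-splits : ∀ {n} m r → suc (m + r) ≡ n → Splits n m r (β n m)
  β-splits m r refl = begin
    ν! (suc (m + r))                                     ≡⟨ ν!-suc (m + r) ⟩
    ν p (suc (m + r)) + ν! (m + r)                       ≡⟨ cong (ν p (suc (m + r)) +_) (binomial-splits m r refl) ⟩
    ν p (suc (m + r)) + (ν p ((m + r) C m) + (ν! m + ν! r)) ≡⟨ sym (+-assoc (ν p (suc (m + r))) _ _) ⟩
    β (suc (m + r)) m + (ν! m + ν! r)                    ∎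
    where open ≡-Reasoning

  -- Legendre at (n, m, r) and at their quotients by p: the lowest digits drop out, and only
  -- the carry t out of the lowest digit survives.
  carry : ∀ {d e f k k'} t m' r' → d < p → e < p → f < p →
    Splits (d + p * (t + m' + r')) (e + p * m') (f + p * r') k →
    Splits (t + m' + r') m' r' k' → k ≡ t + k'
  carry {d} {e} {f} {k} {k'} t m' r' d<p e<p f<p split split' =
    +-cancelʳ-≡ (m' + r' + (ν! m' + ν! r')) k (t + k') (begin
      k + (m' + r' + (ν! m' + ν! r'))                 ≡⟨ interleave k m' r' (ν! m') (ν! r') ⟩
      k + ((m' + ν! m') + (r' + ν! r'))               ≡⟨ cong (k +_) (sym (cong₂ _+_ (ν!-digit e m' e<p) (ν!-digit f r' f<p))) ⟩
      k + (ν! (e + p * m') + ν! (f + p * r'))         ≡⟨ sym split ⟩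
      ν! (d + p * (t + m' + r'))                      ≡⟨ ν!-digit d (t + m' + r') d<p ⟩
      (t + m' + r') + ν! (t + m' + r')                ≡⟨ cong ((t + m' + r') +_) split' ⟩
      (t + m' + r') + (k' + (ν! m' + ν! r'))          ≡⟨ collect t m' r' k' (ν! m' + ν! r') ⟩
      t + k' + (m' + r' + (ν! m' + ν! r'))            ∎)
    where
    open ≡-Reasoning
    interleave : ∀ k m r a b → k + (m + r + (a + b)) ≡ k + ((m + a) + (r + b))
    interleave = solve-∀
    collect : ∀ t m r k x → (t + m + r) + (k + x) ≡ t + k + (m + r + x)
    collect = solve-∀

  ν-C-no-borrow : ∀ {d e n' m'} → e ≤ d → d < p → m' ≤ n' →
    ν p ((d + p * n') C (e + p * m')) ≡ ν p (n' C m')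
  ν-C-no-borrow {e = e} {m' = m'} e≤d d<p m'≤n' with m≤n⇒∃[o]m+o≡n e≤d | m≤n⇒∃[o]m+o≡n m'≤n'
  ... | f , refl | r' , refl =
    carry 0 m' r' d<p (≤-<-trans (m≤m+n e f) d<p) (≤-<-trans (m≤n+m f e) d<p)
      (binomial-splits (e + p * m') (f + p * r') (digit-sum p e f m' r')) (binomial-splits m' r' refl)

  β-no-borrow : ∀ {d e n' m'} → e < d → d < p → m' ≤ n' →
    β (d + p * n') (e + p * m') ≡ ν p (n' C m')
  β-no-borrow {e = e} {m' = m'} e<d d<p m'≤n' with m≤n⇒∃[o]m+o≡n e<d | m≤n⇒∃[o]m+o≡n m'≤n'
  ... | f , refl | r' , refl =
    carry 0 m' r' d<p (<-trans (m≤m+n (suc e) f) d<p) (≤-<-trans (m≤n+m f (suc e)) d<p)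
      (β-splits (e + p * m') (f + p * r') (cong suc (digit-sum p e f m' r'))) (binomial-splits m' r' refl)

  ν-C-borrow : ∀ {d e n' m'} → d < e → e < p → m' < n' →
    ν p ((d + p * n') C (e + p * m')) ≡ suc (β n' m')
  ν-C-borrow {d} {e} {m' = m'} d<e e<p m'<n' with m≤n⇒∃[o]m+o≡n e<p | m≤n⇒∃[o]m+o≡n m'<n'
  ... | c , e+c≡p | r' , refl =
    carry 1 m' r' (<-trans d<e e<p) e<p f<p
      (binomial-splits (e + p * m') (d + suc c + p * r')
        (trans (digit-sum p e (d + suc c) m' r') (carry-sum p m' r' digits)))
      (β-splits m' r' refl)
    where
    f<p : d + suc c < p
    f<p = subst₂ _<_ (sym (+-suc d c)) e+c≡p (s≤s (+-monoˡ-< c d<e))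
    swap : ∀ e d c → e + (d + suc c) ≡ d + (suc e + c)
    swap = solve-∀
    digits : e + (d + suc c) ≡ d + p
    digits = trans (swap e d c) (cong (d +_) e+c≡p)

  β-borrow : ∀ {d e n' m'} → d ≤ e → e < p → m' < n' →
    β (d + p * n') (e + p * m') ≡ suc (β n' m')
  β-borrow {d} {e} {m' = m'} d≤e e<p m'<n' with m≤n⇒∃[o]m+o≡n e<p | m≤n⇒∃[o]m+o≡n m'<n'
  ... | c , e+c≡p | r' , refl =
    carry 1 m' r' (≤-<-trans d≤e e<p) e<p f<p
      (β-splits (e + p * m') (d + c + p * r')
        (trans (cong suc (digit-sum p e (d + c) m' r')) (carry-sum p m' r' digits)))
      (β-splits m' r' refl)
    where
    f<p : d + c < p
    f<p = subst (d + c <_) e+c≡p (s≤s (+-monoˡ-≤ c d≤e))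
    swap : ∀ e d c → suc (e + (d + c)) ≡ d + (suc e + c)
    swap = solve-∀
    digits : suc (e + (d + c)) ≡ d + p
    digits = trans (swap e d c) (cong (d +_) e+c≡p)

module Columns (q : ℕ) (p-prime : Prime (2 + q)) where

  open Kummer q p-prime

  A B : ℕ → Poly
  A n k = sumBelow (λ m → monX (ν p (n C m)) k) (suc n)
  B n k = sumBelow (λ m → monX (suc (β n m)) k) n

  A-digit : ∀ {d} n' → d < p → A (d + p * n') ≐ ((const (d + 1) ⊗ A n') ⊕ (const (p ∸ d ∸ 1) ⊗ B n'))
  A-digit {d} n' d<p k = begin
    A (d + p * n') k
      ≡⟨ sumBelow-digits p (suc d) n' _ _ _ d<p
           (λ e j e≤d j≤n' → cong (λ x → monX x k) (ν-C-no-borrow (≤-pred e≤d) d<p j≤n'))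
           (λ e j d<e e<p j<n' → cong (λ x → monX x k) (ν-C-borrow d<e e<p j<n')) ⟩
    suc d * A n' k + (p ∸ suc d) * B n' k
      ≡⟨ cong₂ (λ x y → x * A n' k + y * B n' k) (+-comm 1 d) (trans (cong (p ∸_) (+-comm 1 d)) (sym (∸-+-assoc p d 1))) ⟩
    (d + 1) * A n' k + (p ∸ d ∸ 1) * B n' k
      ≡⟨ cong₂ _+_ (const-⊗ (d + 1) (A n') k) (const-⊗ (p ∸ d ∸ 1) (B n') k) ⟨
    ((const (d + 1) ⊗ A n') ⊕ (const (p ∸ d ∸ 1) ⊗ B n')) k
      ∎
    where open ≡-Reasoning

  B-constant-term : ∀ n → B n 0 ≡ 0
  B-constant-term n = trans (sumBelow-const 0 n) (*-zeroʳ n)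

  B-digit : ∀ {d} n' → d < p → B (d + p * n') ≐ ((linX d ⊗ A n') ⊕ (linX (p ∸ d) ⊗ B n'))
  B-digit {d} n' d<p zero = trans (B-constant-term (d + p * n'))
    (sym (cong₂ _+_ (linX-⊗ d (A n') 0) (linX-⊗ (p ∸ d) (B n') 0)))
  B-digit {d} n' d<p (suc k) = begin
    B (d + p * n') (suc k)
      ≡⟨ sumBelow-digits p d n' _ _ _ (<⇒≤ d<p)
           (λ e j e<d j≤n' → cong (λ x → monX (suc x) (suc k)) (β-no-borrow e<d d<p j≤n'))
           (λ e j d≤e e<p j<n' → cong (λ x → monX (suc x) (suc k)) (β-borrow d≤e e<p j<n')) ⟩
    d * A n' k + (p ∸ d) * B n' k
      ≡⟨ cong₂ _+_ (linX-⊗ d (A n') (suc k)) (linX-⊗ (p ∸ d) (B n') (suc k)) ⟨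
    ((linX d ⊗ A n') ⊕ (linX (p ∸ d) ⊗ B n')) (suc k)
      ∎
    where open ≡-Reasoning

  rowCol-digit : ∀ R {d} n' → d < p → rowCol R (A (d + p * n')) (B (d + p * n')) ≐ rowCol (R ·M M p d) (A n') (B n')
  rowCol-digit R {d} n' d<p k = trans (rowCol-cong R (A-digit n' d<p) (B-digit n' d<p) k)
    (sym (rowCol-·M R (d + 1) (p ∸ d ∸ 1) d (p ∸ d) (A n') (B n') k))

  rowCol-Mprod : ∀ ds t j → (∀ s → s ≤ t + j → ds s < p) →
    rowCol (Mprod p ds t) (A (fromDigits p ds (suc t) j)) (B (fromDigits p ds (suc t) j))
      ≐ rowCol (Mprod p ds (t + j)) (A 0) (B 0)
  rowCol-Mprod ds t zero    _         rewrite +-identityʳ t = λ _ → refl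
  rowCol-Mprod ds t (suc j) digits<p k = begin
    rowCol (Mprod p ds t) (A (ds (suc t) + p * N)) (B (ds (suc t) + p * N)) k
      ≡⟨ rowCol-digit (Mprod p ds t) N (digits<p (suc t) (subst (suc t ≤_) (sym (+-suc t j)) (s≤s (m≤m+n t j)))) k ⟩
    rowCol (Mprod p ds (suc t)) (A N) (B N) k
      ≡⟨ rowCol-Mprod ds (suc t) j (λ s s≤ → digits<p s (subst (s ≤_) (sym (+-suc t j)) s≤)) k ⟩
    rowCol (Mprod p ds (suc t + j)) (A 0) (B 0) k
      ≡⟨ cong (λ i → rowCol (Mprod p ds i) (A 0) (B 0) k) (sym (+-suc t j)) ⟩
    rowCol (Mprod p ds (t + suc j)) (A 0) (B 0) k
      ∎
    where
    open ≡-Reasoning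
    N = fromDigits p ds (suc (suc t)) j

  A0≐1 : A 0 ≐ const 1
  A0≐1 zero    = cong (λ x → monX x 0) (ν-indivisible 1 p∤1)
  A0≐1 (suc k) = cong (λ x → monX x (suc k)) (ν-indivisible 1 p∤1)

  B0≐0 : B 0 ≐ const 0
  B0≐0 zero    = refl
  B0≐0 (suc k) = refl

  T≐A : ∀ n → T p n ≐ A n
  T≐A n = polySumTo-sumBelow (λ m → monX (ν p (n C m))) n

theorem1 : (p : ℕ) → Prime p → (n ℓ : ℕ) → (ds : ℕ → ℕ) →
    (∀ t → t ≤ ℓ → ds t < p) →
    n ≡ sumTo (λ t → ds t * p ^ t) ℓ →
    (ds ℓ ≢ 0 ⊎ ℓ ≡ 0) →
    T p n ≐ sandwich (Mprod p ds ℓ)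
theorem1 zero          ()
theorem1 (suc zero)    ()
theorem1 p@(suc (suc q)) p-prime n ℓ ds digits<p n≡digits _ k = begin
  T p n k                                       ≡⟨ T≐A n k ⟩
  A n k                                         ≡⟨ cong (λ m → A m k) (trans n≡digits (sumTo-fromDigits p ds 0 ℓ)) ⟩
  A (ds 0 + p * N) k                            ≡⟨ A-digit N (digits<p 0 z≤n) k ⟩
  rowCol (Mprod p ds 0) (A N) (B N) k           ≡⟨ rowCol-Mprod ds 0 ℓ digits<p k ⟩
  rowCol (Mprod p ds ℓ) (A 0) (B 0) k           ≡⟨ rowCol-cong (Mprod p ds ℓ) A0≐1 B0≐0 k ⟩
  rowCol (Mprod p ds ℓ) (const 1) (const 0) k   ≡⟨ rowCol-e₁ (Mprod p ds ℓ) k ⟩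
  a (Mprod p ds ℓ) k                            ≡⟨ sandwich≐a (Mprod p ds ℓ) k ⟨
  sandwich (Mprod p ds ℓ) k                     ∎
  where
  open Columns q p-prime
  open ≡-Reasoning
  N = fromDigits p ds 1 ℓ
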